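{- Let $m,n\ge1$, let $P$ be a partition of $[m]\times[n]$ and let $f:P\to\Sigma^4$ be the most general tile assignment for $P$ (over an infinite glue set $\Sigma$). Then $P$ is constructible if and only if $f$ is injective and the tile set $f(P)$ is deterministic in the sense that there are no two distinct tiles $t_1\neq t_2$ in $f(P)$ with $\sigma_S(t_1)=\sigma_S(t_2)$ and $\sigma_W(t_1)=\sigma_W(t_2)$.
   Context: Directions: $N(x,y)=(x,y+1)$, $E(x,y)=(x+1,y)$, $S=N^{ -1}$, $W=E^{ -1}$, $\mathcal{D}=\{N,E,S,W\}$. A tile type is $t=(\sigma_N(t),\sigma_E(t),\sigma_S(t),\sigma_W(t))\in\Sigma^4$; for $g:P\to\Sigma^4$ write $g(p)_D=\sigma_D(g(p))$ and $[a]\in P$ for the part containing position $a$. A most general tile assignment (MGTA) for $P$ is $f:P\to\Sigma^4$ such that (A1) $f([a])_E=f([E(a)])_W$ and $f([a])_N=f([N(a)])_S$ whenever both positions lie in $[m]\times[n]$; and (A2) for every $g:P\to\Sigma^4$ satisfying (A1) and all $(p_1,D_1),(p_2,D_2)\in P\times\mathcal{D}$, $f(p_1)_{D_1}=f(p_2)_{D_2}$ implies $g(p_1)_{D_1}=g(p_2)_{D_2}$. MGTAs for $P$ exist and are unique up to relabeling of glues; "the" MGTA is a fixed representative. Tile assembly model: a glue strength function $s:\Sigma\times\Sigma\to\mathbb{N}$ is symmetric with $s(\sigma_1,\sigma_2)=0$ if $\sigma_1\ne\sigma_2$. An assembly is a partial map $\mathbb{Z}^2\to\Sigma^4$. A TAS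 $\mathscr{T}=(T,\mathcal{S},s,\tau)$ has a finite tile set $T$, seed assembly $\mathcal{S}$, strength function $s$ and temperature $\tau$. $\mathcal{A}\to_{\mathscr{T}}\mathcal{A}'$ if $\mathcal{A}'=\mathcal{A}\cup\{((x,y),t)\}$ (disjoint) with $t\in T$ and $\sum_D s(\sigma_D(t),\sigma_{D^{ -1}}(\mathcal{A}(D(x,y))))\ge\tau$ over those $D$ with $\mathcal{A}(D(x,y))$ defined; produced assemblies are those reachable from $\mathcal{S}$; terminal assemblies are produced assemblies that cannot be extended. $\mathscr{T}$ is deterministic if for each produced assembly and each position at most one tile of $T$ can extend it there; then $\mathscr{T}$ has a unique terminal assembly $\mathcal{A}$. Properties: (P1) the tiles of $T$ have bonding strength 1 ($s(\sigma,\sigma)=1$ for their glues), with $\tau=2$; (P2) the domain of $\mathcal{S}$ is $[0,m]\times\{0\}\cup\{0\}\times[0,n]$ and all terminal assemblies have domain $[0,m]\times[0,n]$, where $[0,m]=\{0,\dots,m\}$. For a deterministic TAS $\mathscr{T}$ satisfying P1, P2 with unique terminal assembly $\mathcal{A}$, let $P(\mathscr{T})=\{\mathcal{A}^{ -1}(\{t\})\cap([m]\times[n]) : t\in\mathcal{A}([m]\times[n])\}$. A partition $P$ of $[m]\times[n]$ is constructible if $P=P(\mathscr{T})$ for some deterministic TAS $\mathscr{T}=(T,\mathcal{S},s,2)$ with properties P1 and P2. -}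

module Defs where

open import Data.Nat using (ℕ; zero; suc; _+_; _≤_)
open import Data.Integer as ℤ using (ℤ; +_) renaming (_≤_ to _≤ℤ_)
open import Data.Fin using (Fin; toℕ)
open import Data.Maybe using (Maybe; just; nothing)
open import Data.List using (List)
open import Data.List.Membership.Propositional using (_∈_)
open import Data.Product using (Σ; ∃; ∃-syntax; _×_; _,_)
open import Data.Sum using (_⊎_)
open import Data.Empty using (⊥)
open import Relation.Nullary using (¬_)
open import Relation.Binary.PropositionalEquality using (_≡_; _≢_)
open import Function using (_⇔_)
open import Function.Definitions using (Injective)

record Tile : Set where
  constructor tile
  field
    σN σE σS σW : ℕ

data Dir : Set where
  N E S W : Dir

glue : Tile → Dir → ℕ
glue t N = Tile.σN t
glue t E = Tile.σE t
glue t S = Tile.σS t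
glue t W = Tile.σW t

opp : Dir → Dir
opp N = S
opp E = W
opp S = N
opp W = E

Pos : Set
Pos = ℤ × ℤ

move : Dir → Pos → Pos
move N (x , y) = (x , y ℤ.+ ℤ.1ℤ)
move E (x , y) = (x ℤ.+ ℤ.1ℤ , y)
move S (x , y) = (x , y ℤ.- ℤ.1ℤ)
move W (x , y) = (x ℤ.- ℤ.1ℤ , y)

Assembly : Set
Assembly = Pos → Maybe Tile

Defined : Assembly → Pos → Set
Defined A p = ∃[ t ] (A p ≡ just t)

record TAS : Set where
  field
    T     : List Tile
    seed  : Assembly
    s     : ℕ → ℕ → ℕ
    s-sym : ∀ a b → s a b ≡ s b a
    s-off : ∀ a b → a ≢ b → s a b ≡ 0

τ : ℕ
τ = 2

module _ (𝒯 : TAS) where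
  open TAS 𝒯

  sideStrength : Assembly → Pos → Tile → Dir → ℕ
  sideStrength A p t D with A (move D p)
  ... | nothing = 0
  ... | just u  = s (glue t D) (glue u (opp D))

  bindStrength : Assembly → Pos → Tile → ℕ
  bindStrength A p t =
    sideStrength A p t N + sideStrength A p t E
      + sideStrength A p t S + sideStrength A p t W

  CanAttach : Assembly → Pos → Tile → Set
  CanAttach A p t = t ∈ T × A p ≡ nothing × τ ≤ bindStrength A p t

  Step : Assembly → Assembly → Set
  Step A A' = ∃[ p ] ∃[ t ] (CanAttach A p t × A' p ≡ just t
                             × (∀ q → q ≢ p → A' q ≡ A q))

  data Produced : Assembly → Set where
    start : ∀ {A} → (∀ q → A q ≡ seed q) → Produced A
    step  : ∀ {A A'} → Produced A → Step A A' → Produced A'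

  Terminal : Assembly → Set
  Terminal A = Produced A × (∀ p t → ¬ CanAttach A p t)

  Deterministic : Set
  Deterministic = ∀ A → Produced A → ∀ p t₁ t₂ →
    CanAttach A p t₁ → CanAttach A p t₂ → t₁ ≡ t₂

  -- (P1) tiles of T have bonding strength 1 (τ = 2 is built in)
  P1 : Set
  P1 = ∀ t → t ∈ T → ∀ D → s (glue t D) (glue t D) ≡ 1

  InRange : ℕ → ℤ → Set
  InRange k x = + 0 ≤ℤ x × x ≤ℤ + k

  P2 : ℕ → ℕ → Set
  P2 m n =
    (∀ x y → Defined seed (x , y) ⇔
       ((InRange m x × y ≡ + 0) ⊎ (x ≡ + 0 × InRange n y)))
    × (∀ A → Terminal A → ∀ x y →
         Defined A (x , y) ⇔ (InRange m x × InRange n y))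

-- A partition with k parts is represented by a labelling
-- π : Fin m → Fin n → Fin k that is surjective (every part nonempty);
-- index i : Fin m stands for the coordinate x = 1 + toℕ i.
-- Its set of parts P is thereby identified with Fin k.

IsPartitionLabelling : (m n k : ℕ) → (Fin m → Fin n → Fin k) → Set
IsPartitionLabelling m n k π = ∀ c → ∃[ i ] ∃[ j ] (π i j ≡ c)

gridPos : ∀ {m n} → Fin m → Fin n → Pos
gridPos i j = (+ suc (toℕ i) , + suc (toℕ j))

InducesPartition : ∀ {m n k} → (Fin m → Fin n → Fin k) → Assembly → Set
InducesPartition π A =
  ∀ i j i' j' → (A (gridPos i j) ≡ A (gridPos i' j')) ⇔ (π i j ≡ π i' j')

Constructible : (m n k : ℕ) → (Fin m → Fin n → Fin k) → Set
Constructible m n k π =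
  Σ TAS λ 𝒯 → Deterministic 𝒯 × P1 𝒯 × P2 𝒯 m n
    × ∃[ A ] (Terminal 𝒯 A × InducesPartition π A)

A1 : ∀ {m n k} → (Fin m → Fin n → Fin k) → (Fin k → Tile) → Set
A1 π g =
  (∀ i i' j → toℕ i' ≡ suc (toℕ i) → glue (g (π i j)) E ≡ glue (g (π i' j)) W)
  × (∀ i j j' → toℕ j' ≡ suc (toℕ j) → glue (g (π i j)) N ≡ glue (g (π i j')) S)

IsMGTA : ∀ {m n k} → (Fin m → Fin n → Fin k) → (Fin k → Tile) → Set
IsMGTA {k = k} π f =
  A1 π f
  × (∀ (g : Fin k → Tile) → A1 π g →
       ∀ (p₁ : Fin k) (D₁ : Dir) (p₂ : Fin k) (D₂ : Dir) →
       glue (f p₁) D₁ ≡ glue (f p₂) D₂ → glue (g p₁) D₁ ≡ glue (g p₂) D₂)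

DeterministicTileSet : ∀ {k} → (Fin k → Tile) → Set
DeterministicTileSet f =
  ¬ (∃[ p₁ ] ∃[ p₂ ] (f p₁ ≢ f p₂ × Tile.σS (f p₁) ≡ Tile.σS (f p₂)
                                  × Tile.σW (f p₁) ≡ Tile.σW (f p₂)))

module Submission where

-- In a temperature-2 system with unit-strength glues whose seed avoids the grid, every tile
-- of the grid is attached while its north and east neighbours are still absent, so it binds
-- exactly to its south and west neighbours. If such a system constructs P, the tile g(p) it places on a
-- part p therefore satisfies the matching conditions (A1); the most general assignment f
-- refines g, and g is injective because P(𝒯) = P, so f is injective. Two tiles of f(P)
-- with the same south and west glues would give, via g, two tiles of 𝒯 competing for the
-- site where one of them was attached.
--
-- Conversely, seed an L-shaped frame presenting the south glues of the first row and the west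
-- glues of the first column, and take f(P) as the tile set. At a grid cell whose south and west
-- neighbours are present, the glues determine the tile, and by the determinism of f(P) it is
-- the one f assigns to the cell's part. Hence every produced assembly lies inside the filled
-- rectangle, which is reached by filling the grid in row-major order; it is the unique
-- terminal assembly, and it induces P because f is injective.

open import Defs
open import Data.Bool using (true; false; if_then_else_)
open import Data.Empty using (⊥; ⊥-elim)
import Data.Fin as Fin
open import Data.Fin using (Fin; toℕ)
import Data.Fin.Properties as Fin
open import Data.Integer as ℤ using (+_; -[1+_])
import Data.List as List
open import Data.List.Membership.Propositional using (_∈_)
open import Data.List.Membership.Propositional.Properties using (∈-map⁺; ∈-map⁻; ∈-allFin)
open import Data.Maybe using (Maybe; just; nothing)
import Data.Maybe as Maybe
open import Data.Maybe.Properties using (just-injective)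
open import Data.Nat using (ℕ; zero; suc; _+_; _*_; _≤_; _<_; z≤n; s≤s)
import Data.Nat.Properties as ℕ
open import Data.Nat.Properties using (_<?_)
open import Data.Product using (∃-syntax; _×_; _,_; proj₁; proj₂)
open import Data.Product.Properties using (≡-dec)
open import Data.Sum using (_⊎_; inj₁; inj₂)
open import Function using (_∘_; _⇔_; mk⇔; Equivalence)
open import Function.Definitions using (Injective)
open import Relation.Binary.PropositionalEquality
open import Relation.Nullary using (¬_; Dec; yes; no; does)
open import Relation.Nullary.Decidable using (dec-true; dec-false)

tile-ext : ∀ {t u : Tile} → (∀ D → glue t D ≡ glue u D) → t ≡ u
tile-ext {tile _ _ _ _} {tile _ _ _ _} h with h N | h E | h S | h W
... | refl | refl | refl | refl = refl

_≟ᵗ_ : (t u : Tile) → Dec (t ≡ u)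
t ≟ᵗ u with Tile.σN t ℕ.≟ Tile.σN u | Tile.σE t ℕ.≟ Tile.σE u
          | Tile.σS t ℕ.≟ Tile.σS u | Tile.σW t ℕ.≟ Tile.σW u
... | yes eN | yes eE | yes eS | yes eW = yes (tile-ext λ { N → eN ; E → eE ; S → eS ; W → eW })
... | no ne | _ | _ | _ = no (ne ∘ cong Tile.σN)
... | _ | no ne | _ | _ = no (ne ∘ cong Tile.σE)
... | _ | _ | no ne | _ = no (ne ∘ cong Tile.σS)
... | _ | _ | _ | no ne = no (ne ∘ cong Tile.σW)

mgta-refines : ∀ {m n k} {π : Fin m → Fin n → Fin k} {f g : Fin k → Tile} →
               IsMGTA π f → A1 π g → ∀ {c₁ c₂} → f c₁ ≡ f c₂ → g c₁ ≡ g c₂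
mgta-refines (_ , general) a1 eq = tile-ext (λ D → general _ a1 _ D _ D (cong (λ t → glue t D) eq))

_≟ᵖ_ : (p q : Pos) → Dec (p ≡ q)
_≟ᵖ_ = ≡-dec ℤ._≟_ ℤ._≟_

move-N : ∀ x b → move N (x , + b) ≡ (x , + suc b)
move-N x b = cong (λ y → (x , + y)) (ℕ.+-comm b 1)

move-E : ∀ a y → move E (+ a , y) ≡ (+ suc a , y)
move-E a y = cong (λ x → (+ x , y)) (ℕ.+-comm a 1)

+-in-range : ∀ 𝒯 {k a} → a ≤ k → InRange 𝒯 k (+ a)
+-in-range 𝒯 a≤k = ℤ.+≤+ z≤n , ℤ.+≤+ a≤k

+-in-range⁻ : ∀ 𝒯 {k a} → InRange 𝒯 k (+ a) → a ≤ k
+-in-range⁻ 𝒯 (_ , ℤ.+≤+ a≤k) = a≤k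

-[1+]-not-in-range : ∀ 𝒯 {k a} → ¬ InRange 𝒯 k -[1+ a ]
-[1+]-not-in-range 𝒯 (() , _)

nothing≢just : ∀ {A : Set} {x : A} → nothing ≢ just x
nothing≢just ()

_⊑_ : Assembly → Assembly → Set
A ⊑ B = ∀ q {u} → A q ≡ just u → B q ≡ just u

⊑-trans : ∀ {A B C} → A ⊑ B → B ⊑ C → A ⊑ C
⊑-trans A⊑B B⊑C q = B⊑C q ∘ A⊑B q

⊑-vacant : ∀ {A B q} → A ⊑ B → B q ≡ nothing → A q ≡ nothing
⊑-vacant {A} {q = q} A⊑B vacant with A q in eq
... | nothing = refl
... | just u  = ⊥-elim (nothing≢just (trans (sym vacant) (A⊑B q eq)))

m+n≥2⇒m≡1×n≡1 : ∀ {a b} → a ≤ 1 → b ≤ 1 → 2 ≤ a + b → a ≡ 1 × b ≡ 1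
m+n≥2⇒m≡1×n≡1 (s≤s z≤n) (s≤s z≤n) _       = refl , refl
m+n≥2⇒m≡1×n≡1 z≤n       (s≤s z≤n) (s≤s ())
m+n≥2⇒m≡1×n≡1 (s≤s z≤n) z≤n       (s≤s ())

if-const : ∀ {A : Set} c (x : A) → (if c then x else x) ≡ x
if-const true  x = refl
if-const false x = refl

does-<-suc : ∀ {x K} → x ≢ K → does (x <? suc K) ≡ does (x <? K)
does-<-suc {x} {K} x≢K with x <? K
... | yes x<K = trans (dec-true (x <? suc K) (ℕ.m<n⇒m<1+n x<K)) (sym (dec-true (x <? K) x<K))
... | no x≮K  = trans (dec-false (x <? suc K) (λ x<1+K → x≮K (ℕ.≤∧≢⇒< (ℕ.≤-pred x<1+K) x≢K)))
                     (sym (dec-false (x <? K) x≮K))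

row-major-injective : ∀ m {a a′ b b′} → a < m → a′ < m → b * m + a ≡ b′ * m + a′ → a ≡ a′ × b ≡ b′
row-major-injective m {b = zero} {zero} _ _ eq = eq , refl
row-major-injective m {a} {a′} {zero} {suc b′} a<m _ eq =
  ⊥-elim (ℕ.<⇒≱ a<m (subst (m ≤_) (sym eq) (ℕ.≤-trans (ℕ.m≤m+n m (b′ * m)) (ℕ.m≤m+n _ a′))))
row-major-injective m {a} {a′} {suc b} {zero} _ a′<m eq =
  ⊥-elim (ℕ.<⇒≱ a′<m (subst (m ≤_) eq (ℕ.≤-trans (ℕ.m≤m+n m (b * m)) (ℕ.m≤m+n _ a))))
row-major-injective m {a} {a′} {suc b} {suc b′} a<m a′<m eq
  with row-major-injective m {b = b} {b′} a<m a′<m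
         (ℕ.+-cancelˡ-≡ m _ _ (trans (sym (ℕ.+-assoc m (b * m) a)) (trans eq (ℕ.+-assoc m (b′ * m) a′))))
... | a≡a′ , b≡b′ = a≡a′ , cong suc b≡b′

fin? : (k : ℕ) → ℕ → Maybe (Fin k)
fin? zero    _       = nothing
fin? (suc k) zero    = just Fin.zero
fin? (suc k) (suc a) = Maybe.map Fin.suc (fin? k a)

fin?-toℕ : ∀ {k} (i : Fin k) → fin? k (toℕ i) ≡ just i
fin?-toℕ Fin.zero    = refl
fin?-toℕ (Fin.suc i) rewrite fin?-toℕ i = refl

fin?-just : ∀ k a {i} → fin? k a ≡ just i → toℕ i ≡ a
fin?-just (suc k) zero    refl = refl
fin?-just (suc k) (suc a) eq with fin? k a in eq′
fin?-just (suc k) (suc a) refl | just j = cong suc (fin?-just k a eq′)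

fin?-just⇒< : ∀ k a {i} → fin? k a ≡ just i → a < k
fin?-just⇒< k a {i} eq = subst (_< k) (fin?-just k a eq) (Fin.toℕ<n i)

fin?-< : ∀ {k a} → a < k → ∃[ i ] fin? k a ≡ just i
fin?-< a<k = Fin.fromℕ< a<k , subst (λ a → fin? _ a ≡ just (Fin.fromℕ< a<k)) (Fin.toℕ-fromℕ< a<k) (fin?-toℕ _)

fin?-pred : ∀ k a {i} → fin? k (suc a) ≡ just i → ∃[ i′ ] fin? k a ≡ just i′
fin?-pred k a eq = fin?-< (ℕ.<-trans (ℕ.n<1+n a) (fin?-just⇒< k (suc a) eq))

fin?-nothing⇒≥ : ∀ k a → fin? k a ≡ nothing → k ≤ a
fin?-nothing⇒≥ zero    a       _  = z≤n
fin?-nothing⇒≥ (suc k) (suc a) eq with fin? k a in eq′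
fin?-nothing⇒≥ (suc k) (suc a) refl | nothing = s≤s (fin?-nothing⇒≥ k a eq′)

fin?-≥ : ∀ {k a} → k ≤ a → fin? k a ≡ nothing
fin?-≥ {zero}          _         = refl
fin?-≥ {suc k} {suc a} (s≤s k≤a) rewrite fin?-≥ k≤a = refl

map-fin?-defined⇔ : ∀ {X : Set} k a (g : Fin k → X) → (∃[ x ] Maybe.map g (fin? k a) ≡ just x) ⇔ a < k
map-fin?-defined⇔ k a g = mk⇔ to from
  where
    to : ∃[ x ] Maybe.map g (fin? k a) ≡ just x → a < k
    to (x , eq) with fin? k a in eq′
    ... | just i = fin?-just⇒< k a eq′
    from : a < k → ∃[ x ] Maybe.map g (fin? k a) ≡ just x
    from a<k with fin?-< a<k
    ... | i , eq rewrite eq = g i , refl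

unitStrength : ℕ → ℕ → ℕ
unitStrength a b = if does (a ℕ.≟ b) then 1 else 0

unitStrength-refl : ∀ a → unitStrength a a ≡ 1
unitStrength-refl a rewrite dec-true (a ℕ.≟ a) refl = refl

unitStrength-off : ∀ a b → a ≢ b → unitStrength a b ≡ 0
unitStrength-off a b a≢b rewrite dec-false (a ℕ.≟ b) a≢b = refl

unitStrength-sym : ∀ a b → unitStrength a b ≡ unitStrength b a
unitStrength-sym a b with a ℕ.≟ b
... | yes refl = refl
... | no a≢b   = trans (unitStrength-off a b a≢b) (sym (unitStrength-off b a (a≢b ∘ sym)))

-- Growth in a tile assembly system

module Production (𝒯 : TAS) where
  open TAS 𝒯

  record BindsOn (A : Assembly) (p : Pos) (t : Tile) (D : Dir) : Set where
    constructor binds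
    field
      neighbour : Tile
      present   : A (move D p) ≡ just neighbour
      matching  : glue t D ≡ glue neighbour (opp D)

  bindsOn-⊑ : ∀ {A A′ p t D} → A ⊑ A′ → BindsOn A p t D → BindsOn A′ p t D
  bindsOn-⊑ A⊑A′ (binds u present eq) = binds u (A⊑A′ _ present) eq

  bindsOn-agree : ∀ {A A′ p t D} → A (move D p) ≡ A′ (move D p) → BindsOn A′ p t D → BindsOn A p t D
  bindsOn-agree A≡A′ (binds u present eq) = binds u (trans A≡A′ present) eq

  bindsOn-same-glue : ∀ {A p t t′ D} → BindsOn A p t D → BindsOn A p t′ D → glue t D ≡ glue t′ D
  bindsOn-same-glue (binds u present eq) (binds u′ present′ eq′) with trans (sym present) present′
  ... | refl = trans eq (sym eq′)

  step-⊒ : ∀ {A A′} → Step 𝒯 A A′ → A ⊑ A′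
  step-⊒ (p , t , (_ , vacant , _) , _ , elsewhere) q occupied with q ≟ᵖ p
  ... | yes refl = ⊥-elim (nothing≢just (trans (sym vacant) occupied))
  ... | no q≢p   = trans (elsewhere q q≢p) occupied

  seed⊑produced : ∀ {A} → Produced 𝒯 A → seed ⊑ A
  seed⊑produced (start A≗seed) q occupied = trans (A≗seed q) occupied
  seed⊑produced (step d s)                = ⊑-trans (seed⊑produced d) (step-⊒ s)

  attach-off-seed : ∀ {A p t u} → Produced 𝒯 A → CanAttach 𝒯 A p t → seed p ≢ just u
  attach-off-seed d (_ , vacant , _) in-seed = nothing≢just (trans (sym vacant) (seed⊑produced d _ in-seed))

  produced-≗ : ∀ {A A′} → Produced 𝒯 A → (∀ q → A q ≡ A′ q) → Produced 𝒯 A′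
  produced-≗ (start A≗seed) A≗A′ = start (λ q → trans (sym (A≗A′ q)) (A≗seed q))
  produced-≗ (step d (p , t , attach , A′p , elsewhere)) A≗A′ =
    step d (p , t , attach , trans (sym (A≗A′ p)) A′p , λ q q≢p → trans (sym (A≗A′ q)) (elsewhere q q≢p))

module UnitStrength (𝒯 : TAS) (p1 : P1 𝒯) where
  open TAS 𝒯
  open Production 𝒯

  module _ {A : Assembly} {p : Pos} {t : Tile} where

    private
      σ : Dir → ℕ
      σ = sideStrength 𝒯 A p t

    vacant⇒side≡0 : ∀ D → A (move D p) ≡ nothing → σ D ≡ 0
    vacant⇒side≡0 D vacant rewrite vacant = refl

    side≤1 : t ∈ T → ∀ D → σ D ≤ 1
    side≤1 t∈T D with A (move D p)
    ... | nothing = z≤n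
    ... | just u with glue t D ℕ.≟ glue u (opp D)
    ...   | yes eq rewrite sym eq | p1 t t∈T D = ℕ.≤-refl
    ...   | no ne  rewrite s-off _ _ ne = z≤n

    side≡1⇒bindsOn : ∀ D → σ D ≡ 1 → BindsOn A p t D
    side≡1⇒bindsOn D σ≡1 with A (move D p) in present
    ... | just u = binds u present matching
      where
        matching : glue t D ≡ glue u (opp D)
        matching with glue t D ℕ.≟ glue u (opp D)
        ... | yes eq = eq
        ... | no ne with trans (sym σ≡1) (s-off _ _ ne)
        ...   | ()

    bindsOn⇒side≡1 : t ∈ T → ∀ D → BindsOn A p t D → σ D ≡ 1
    bindsOn⇒side≡1 t∈T D (binds u present eq) rewrite present | sym eq = p1 t t∈T D

    bindStrength-lone-side : ∀ D → (∀ D′ → D′ ≢ D → σ D′ ≡ 0) → bindStrength 𝒯 A p t ≡ σ D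
    bindStrength-lone-side N others rewrite others E (λ ()) | others S (λ ()) | others W (λ ()) =
      trans (ℕ.+-identityʳ _) (trans (ℕ.+-identityʳ _) (ℕ.+-identityʳ _))
    bindStrength-lone-side E others rewrite others N (λ ()) | others S (λ ()) | others W (λ ()) =
      trans (ℕ.+-identityʳ _) (ℕ.+-identityʳ _)
    bindStrength-lone-side S others rewrite others N (λ ()) | others E (λ ()) | others W (λ ()) =
      ℕ.+-identityʳ _
    bindStrength-lone-side W others rewrite others N (λ ()) | others E (λ ()) | others S (λ ()) =
      refl

    attach-needs-two-sides : t ∈ T → ∀ D → (∀ D′ → D′ ≢ D → A (move D′ p) ≡ nothing) → ¬ (τ ≤ bindStrength 𝒯 A p t)
    attach-needs-two-sides t∈T D vacant = ℕ.≤⇒≯ (subst (_≤ 1) (sym lone) (side≤1 t∈T D))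
      where lone = bindStrength-lone-side D (λ D′ D′≢D → vacant⇒side≡0 D′ (vacant D′ D′≢D))

    attach⇒bindsOn-south-west : CanAttach 𝒯 A p t → A (move N p) ≡ nothing → A (move E p) ≡ nothing →
                                BindsOn A p t S × BindsOn A p t W
    attach⇒bindsOn-south-west (t∈T , _ , 2≤) vacantN vacantE
      rewrite vacant⇒side≡0 N vacantN | vacant⇒side≡0 E vacantE
      with m+n≥2⇒m≡1×n≡1 (side≤1 t∈T S) (side≤1 t∈T W) 2≤
    ... | σS≡1 , σW≡1 = side≡1⇒bindsOn S σS≡1 , side≡1⇒bindsOn W σW≡1

    bindsOn-south-west⇒attach : t ∈ T → A p ≡ nothing → BindsOn A p t S → BindsOn A p t W → CanAttach 𝒯 A p t
    bindsOn-south-west⇒attach t∈T vacant south west = t∈T , vacant , 2≤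
      where
        2≤ : τ ≤ bindStrength 𝒯 A p t
        2≤ rewrite bindsOn⇒side≡1 t∈T S south | bindsOn⇒side≡1 t∈T W west =
          subst (2 ≤_) (sym (ℕ.+-assoc _ 1 1)) (ℕ.m≤n+m 2 _)

  record AttachedFromSouthWest (B : Assembly) (q : Pos) (u : Tile) : Set where
    field
      before          : Assembly
      before-produced : Produced 𝒯 before
      before⊑         : before ⊑ B
      attachable      : CanAttach 𝒯 before q u
      south           : BindsOn before q u S
      west            : BindsOn before q u W

  -- Each tile of the open quadrant arrives after its south and west neighbours,
  -- hence before its north and east ones, so it can only bind to the former.
  module _ (seed-off-quadrant : ∀ a b → seed (+ suc a , + suc b) ≡ nothing) where

    mutual
      quadrant-tile-history : ∀ {B} → Produced 𝒯 B → ∀ a b {u} → B (+ suc a , + suc b) ≡ just u →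
                              AttachedFromSouthWest B (+ suc a , + suc b) u
      quadrant-tile-history (start B≗seed) a b occupied =
        ⊥-elim (nothing≢just (trans (sym (seed-off-quadrant a b)) (trans (sym (B≗seed _)) occupied)))
      quadrant-tile-history (step {B₀} d s@(p , t , attach , Bp , elsewhere)) a b occupied
        with (+ suc a , + suc b) ≟ᵖ p
      ... | no q≢p = record
        { before = before ; before-produced = before-produced ; before⊑ = ⊑-trans before⊑ (step-⊒ s)
        ; attachable = attachable ; south = south ; west = west }
        where open AttachedFromSouthWest (quadrant-tile-history d a b (trans (sym (elsewhere _ q≢p)) occupied))
      ... | yes refl with just-injective (trans (sym Bp) occupied)
      ...   | refl = record
        { before = B₀ ; before-produced = d ; before⊑ = step-⊒ s ; attachable = attach
        ; south = proj₁ bound ; west = proj₂ bound }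
        where bound = quadrant-attach⇒bindsOn-south-west d attach

      quadrant-attach⇒bindsOn-south-west : ∀ {B a b t} → Produced 𝒯 B → CanAttach 𝒯 B (+ suc a , + suc b) t →
                                            BindsOn B (+ suc a , + suc b) t S × BindsOn B (+ suc a , + suc b) t W
      quadrant-attach⇒bindsOn-south-west {B} {a} {b} d attach =
        attach⇒bindsOn-south-west attach (trans (cong B (move-N _ (suc b))) vacantN)
                                         (trans (cong B (move-E (suc a) _)) vacantE)
        where
          vacant : B (+ suc a , + suc b) ≡ nothing
          vacant = proj₁ (proj₂ attach)
          vacantN : B (+ suc a , + suc (suc b)) ≡ nothing
          vacantN with B (+ suc a , + suc (suc b)) in eq
          ... | nothing = refl
          ... | just _  = ⊥-elim (nothing≢just (trans (sym vacant) (before⊑ _ (BindsOn.present south))))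
            where open AttachedFromSouthWest (quadrant-tile-history d a (suc b) eq)
          vacantE : B (+ suc (suc a) , + suc b) ≡ nothing
          vacantE with B (+ suc (suc a) , + suc b) in eq
          ... | nothing = refl
          ... | just _  = ⊥-elim (nothing≢just (trans (sym vacant) (before⊑ _ (BindsOn.present west))))
            where open AttachedFromSouthWest (quadrant-tile-history d (suc a) b eq)

-- Necessity

module Necessity {m n k : ℕ} (π : Fin m → Fin n → Fin k) (surj : IsPartitionLabelling m n k π)
                 (𝒯 : TAS) (det : Deterministic 𝒯) (p1 : P1 𝒯) (p2 : P2 𝒯 m n)
                 (A : Assembly) (terminal : Terminal 𝒯 A) (induces : InducesPartition π A) where
  open TAS 𝒯
  open Production 𝒯
  open UnitStrength 𝒯 p1
  open Equivalence

  seed-off-quadrant : ∀ a b → seed (+ suc a , + suc b) ≡ nothing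
  seed-off-quadrant a b with seed (+ suc a , + suc b) in eq
  ... | nothing = refl
  ... | just u with to (proj₁ p2 (+ suc a) (+ suc b)) (u , eq)
  ...   | inj₁ (_ , ())
  ...   | inj₂ (() , _)

  occupied : ∀ i j → ∃[ u ] A (gridPos i j) ≡ just u
  occupied i j = from (proj₂ p2 A terminal _ _) (+-in-range 𝒯 (Fin.toℕ<n i) , +-in-range 𝒯 (Fin.toℕ<n j))

  tileAt : Fin m → Fin n → Tile
  tileAt i j = proj₁ (occupied i j)

  A-gridPos : ∀ i j → A (gridPos i j) ≡ just (tileAt i j)
  A-gridPos i j = proj₂ (occupied i j)

  tileAt-≡⇔π-≡ : ∀ i j i′ j′ → tileAt i j ≡ tileAt i′ j′ ⇔ π i j ≡ π i′ j′
  tileAt-≡⇔π-≡ i j i′ j′ = mk⇔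
    (λ eq → to (induces i j i′ j′) (trans (A-gridPos i j) (trans (cong just eq) (sym (A-gridPos i′ j′)))))
    (λ eq → just-injective (trans (sym (A-gridPos i j)) (trans (from (induces i j i′ j′) eq) (A-gridPos i′ j′))))

  repᵢ : Fin k → Fin m
  repᵢ c = proj₁ (surj c)

  repⱼ : Fin k → Fin n
  repⱼ c = proj₁ (proj₂ (surj c))

  π-rep : ∀ c → π (repᵢ c) (repⱼ c) ≡ c
  π-rep c = proj₂ (proj₂ (surj c))

  g : Fin k → Tile
  g c = tileAt (repᵢ c) (repⱼ c)

  g-π : ∀ i j → g (π i j) ≡ tileAt i j
  g-π i j = from (tileAt-≡⇔π-≡ _ _ i j) (π-rep (π i j))

  g-injective : Injective _≡_ _≡_ g
  g-injective {c₁} {c₂} eq = trans (sym (π-rep c₁)) (trans (to (tileAt-≡⇔π-≡ _ _ _ _) eq) (π-rep c₂))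

  history : ∀ i j → AttachedFromSouthWest A (gridPos i j) (tileAt i j)
  history i j = quadrant-tile-history seed-off-quadrant (proj₁ terminal) (toℕ i) (toℕ j) (A-gridPos i j)

  west-neighbour : ∀ i i′ j → toℕ i′ ≡ suc (toℕ i) → glue (tileAt i′ j) W ≡ glue (tileAt i j) E
  west-neighbour i i′ j i′≡1+i with bindsOn-⊑ before⊑ west
    where open AttachedFromSouthWest (history i′ j)
  ... | binds w Aw eq = trans eq (cong (λ u → glue u E) (just-injective (trans (sym Aw′) (A-gridPos i j))))
    where
      Aw′ : A (gridPos i j) ≡ just w
      Aw′ = subst (λ x → A (+ x , + suc (toℕ j)) ≡ just w) i′≡1+i Aw

  south-neighbour : ∀ i j j′ → toℕ j′ ≡ suc (toℕ j) → glue (tileAt i j′) S ≡ glue (tileAt i j) N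
  south-neighbour i j j′ j′≡1+j with bindsOn-⊑ before⊑ south
    where open AttachedFromSouthWest (history i j′)
  ... | binds w Aw eq = trans eq (cong (λ u → glue u N) (just-injective (trans (sym Aw′) (A-gridPos i j))))
    where
      Aw′ : A (gridPos i j) ≡ just w
      Aw′ = subst (λ y → A (+ suc (toℕ i) , + y) ≡ just w) j′≡1+j Aw

  g-A1 : A1 π g
  g-A1 = (λ i i′ j eq → subst₂ (λ u v → glue u E ≡ glue v W) (sym (g-π i j)) (sym (g-π i′ j)) (sym (west-neighbour i i′ j eq)))
       , (λ i j j′ eq → subst₂ (λ u v → glue u N ≡ glue v S) (sym (g-π i j)) (sym (g-π i j′)) (sym (south-neighbour i j j′ eq)))

  g-determined-by-south-west : ∀ c₁ c₂ → glue (g c₁) S ≡ glue (g c₂) S → glue (g c₁) W ≡ glue (g c₂) W → g c₁ ≡ g c₂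
  g-determined-by-south-west c₁ c₂ eqS eqW =
    det before before-produced q (g c₁) (g c₂)
        (bindsOn-south-west⇒attach g₁∈T (proj₁ (proj₂ attachable)) (retarget S eqS south) (retarget W eqW west))
        attachable
    where
      open AttachedFromSouthWest (history (repᵢ c₂) (repⱼ c₂))
      q = gridPos (repᵢ c₂) (repⱼ c₂)
      g₁∈T : g c₁ ∈ T
      g₁∈T = proj₁ (AttachedFromSouthWest.attachable (history (repᵢ c₁) (repⱼ c₁)))
      retarget : ∀ D → glue (g c₁) D ≡ glue (g c₂) D → BindsOn before q (g c₂) D → BindsOn before q (g c₁) D
      retarget D eq (binds w present eq′) = binds w present (trans eq eq′)

  mgta-injective : ∀ {f} → IsMGTA π f → Injective _≡_ _≡_ f
  mgta-injective mgta = g-injective ∘ mgta-refines mgta g-A1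

  mgta-deterministic : ∀ {f} → IsMGTA π f → DeterministicTileSet f
  mgta-deterministic {f} (_ , general) (c₁ , c₂ , f₁≢f₂ , eqS , eqW) =
    f₁≢f₂ (cong f (g-injective (g-determined-by-south-west c₁ c₂ (general g g-A1 c₁ S c₂ S eqS)
                                                                   (general g g-A1 c₁ W c₂ W eqW))))

-- Sufficiency

module Sufficiency {m′ n′ k : ℕ} (π : Fin (suc m′) → Fin (suc n′) → Fin k) (f : Fin k → Tile) (a1 : A1 π f) where

  m n : ℕ
  m = suc m′
  n = suc n′

  cellTile : Maybe (Fin m) → Maybe (Fin n) → Maybe Tile
  cellTile nothing  _        = nothing
  cellTile (just i) nothing  = nothing
  cellTile (just i) (just j) = just (f (π i j))

  cellTile-nothingʳ : ∀ x → cellTile x nothing ≡ nothing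
  cellTile-nothingʳ nothing  = refl
  cellTile-nothingʳ (just _) = refl

  bottomTile : Maybe (Fin m) → Maybe Tile
  bottomTile = Maybe.map (λ i → tile (glue (f (π i Fin.zero)) S) 0 0 0)

  leftTile : Maybe (Fin n) → Maybe Tile
  leftTile = Maybe.map (λ j → tile 0 (glue (f (π Fin.zero j)) W) 0 0)

  -- Position (1 + a , 1 + b) of the grid carries f of the part of (a , b); the frame on the
  -- axes offers the south glues of the first row and the west glues of the first column.
  full : Assembly
  full (+ zero  , + zero)  = just (tile 0 0 0 0)
  full (+ suc a , + zero)  = bottomTile (fin? m a)
  full (+ zero  , + suc b) = leftTile (fin? n b)
  full (+ suc a , + suc b) = cellTile (fin? m a) (fin? n b)
  full _                   = nothing

  -- the frame together with the first K cells of the grid in row-major order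
  grown : ℕ → Assembly
  grown K (+ suc a , + suc b) = if does (b * m + a <? K) then full (+ suc a , + suc b) else nothing
  grown K q                   = full q

  𝒯 : TAS
  𝒯 = record { T = List.map f (List.allFin k) ; seed = grown 0 ; s = unitStrength
             ; s-sym = unitStrength-sym ; s-off = unitStrength-off }

  open TAS 𝒯 using (T; seed)
  open Production 𝒯

  p1 : P1 𝒯
  p1 t _ D = unitStrength-refl (glue t D)

  open UnitStrength 𝒯 p1
  open Equivalence

  seed-off-quadrant : ∀ a b → seed (+ suc a , + suc b) ≡ nothing
  seed-off-quadrant _ _ = refl

  f∈T : ∀ c → f c ∈ T
  f∈T c = ∈-map⁺ f (∈-allFin c)

  full-south : ∀ {a b i j} → fin? m a ≡ just i → fin? n b ≡ just j → BindsOn full (+ suc a , + suc b) (f (π i j)) S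
  full-south {a} {zero}          ea refl = binds _ (cong bottomTile ea) refl
  full-south {a} {suc b} {i} {j} ea eb with fin?-pred n b eb
  ... | j′ , eb′ = binds _ (cong₂ cellTile ea eb′)
                     (sym (proj₂ a1 i j′ j (trans (fin?-just n (suc b) eb) (cong suc (sym (fin?-just n b eb′))))))

  full-west : ∀ {a b i j} → fin? m a ≡ just i → fin? n b ≡ just j → BindsOn full (+ suc a , + suc b) (f (π i j)) W
  full-west {zero}          {b} refl eb = binds _ (cong leftTile eb) refl
  full-west {suc a} {b} {i} {j} ea eb with fin?-pred m a ea
  ... | i′ , ea′ = binds _ (cong₂ cellTile ea′ eb)
                     (sym (proj₁ a1 i′ i j (trans (fin?-just m (suc a) ea) (cong suc (sym (fin?-just m a ea′))))))

  full-east-of-grid : ∀ {a} → m ≤ a → ∀ y → full (+ suc a , y) ≡ nothing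
  full-east-of-grid m≤a (+ zero)  rewrite fin?-≥ m≤a = refl
  full-east-of-grid m≤a (+ suc b) rewrite fin?-≥ m≤a = refl
  full-east-of-grid m≤a -[1+ b ]  = refl

  full-north-of-grid : ∀ {b} → n ≤ b → ∀ x → full (x , + suc b) ≡ nothing
  full-north-of-grid n≤b (+ zero)  rewrite fin?-≥ n≤b = refl
  full-north-of-grid n≤b (+ suc a) rewrite fin?-≥ n≤b = cellTile-nothingʳ (fin? m a)
  full-north-of-grid n≤b -[1+ a ]  = refl

  full-below : ∀ x b → full (x , -[1+ b ]) ≡ nothing
  full-below (+ zero)  b = refl
  full-below (+ suc a) b = refl
  full-below -[1+ a ]  b = refl

  full-gridPos : ∀ i j → full (gridPos i j) ≡ just (f (π i j))
  full-gridPos i j rewrite fin?-toℕ i | fin?-toℕ j = refl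

  full-domain : ∀ x y {u} → full (x , y) ≡ just u → InRange 𝒯 m x × InRange 𝒯 n y
  full-domain (+ zero)  (+ zero)  _  = +-in-range 𝒯 z≤n , +-in-range 𝒯 z≤n
  full-domain (+ suc a) (+ zero)  eq = +-in-range 𝒯 (to (map-fin?-defined⇔ m a _) (_ , eq)) , +-in-range 𝒯 z≤n
  full-domain (+ zero)  (+ suc b) eq = +-in-range 𝒯 z≤n , +-in-range 𝒯 (to (map-fin?-defined⇔ n b _) (_ , eq))
  full-domain (+ suc a) (+ suc b) eq with fin? m a in ea | fin? n b in eb
  ... | just _ | just _ = +-in-range 𝒯 (fin?-just⇒< m a ea) , +-in-range 𝒯 (fin?-just⇒< n b eb)

  seed-domain : ∀ x y → Defined seed (x , y) ⇔ ((InRange 𝒯 m x × y ≡ + 0) ⊎ (x ≡ + 0 × InRange 𝒯 n y))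
  seed-domain (+ zero)  (+ zero)  = mk⇔ (λ _ → inj₁ (+-in-range 𝒯 z≤n , refl)) (λ _ → _ , refl)
  seed-domain (+ suc a) (+ zero)  = mk⇔
    (λ occupied → inj₁ (+-in-range 𝒯 (to (map-fin?-defined⇔ m a _) occupied) , refl))
    (λ { (inj₁ (in-range , _)) → from (map-fin?-defined⇔ m a _) (+-in-range⁻ 𝒯 in-range) ; (inj₂ (() , _)) })
  seed-domain (+ zero)  (+ suc b) = mk⇔
    (λ occupied → inj₂ (refl , +-in-range 𝒯 (to (map-fin?-defined⇔ n b _) occupied)))
    (λ { (inj₂ (_ , in-range)) → from (map-fin?-defined⇔ n b _) (+-in-range⁻ 𝒯 in-range) ; (inj₁ (_ , ())) })
  seed-domain (+ suc a) (+ suc b) = mk⇔ (λ { (_ , ()) }) (λ { (inj₁ (_ , ())) ; (inj₂ (() , _)) })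
  seed-domain (+ zero)  -[1+ b ]  = mk⇔ (λ { (_ , ()) })
    (λ { (inj₁ (_ , ())) ; (inj₂ (_ , in-range)) → ⊥-elim (-[1+]-not-in-range 𝒯 in-range) })
  seed-domain (+ suc a) -[1+ b ]  = mk⇔ (λ { (_ , ()) })
    (λ { (inj₁ (_ , ())) ; (inj₂ (_ , in-range)) → ⊥-elim (-[1+]-not-in-range 𝒯 in-range) })
  seed-domain -[1+ a ]  y         = mk⇔ (λ { (_ , ()) })
    (λ { (inj₁ (in-range , _)) → ⊥-elim (-[1+]-not-in-range 𝒯 in-range) ; (inj₂ (() , _)) })

  grown⊑full : ∀ K → grown K ⊑ full
  grown⊑full K (+ suc a , + suc b) eq with does (b * m + a <? K)
  ... | true = eq
  grown⊑full K (+ zero  , y)        eq = eq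
  grown⊑full K (+ suc a , + zero)   eq = eq
  grown⊑full K (+ suc a , -[1+ b ]) eq = eq
  grown⊑full K (-[1+ a ] , y)       eq = eq

  grown-south : ∀ a b → grown (b * m + a) (+ suc a , + b) ≡ full (+ suc a , + b)
  grown-south a zero    = refl
  grown-south a (suc b) rewrite dec-true (b * m + a <? suc b * m + a) (ℕ.+-monoˡ-< a (ℕ.m<n+m (b * m) (ℕ.0<1+n {m′}))) = refl

  grown-west : ∀ a b → grown (b * m + a) (+ a , + suc b) ≡ full (+ a , + suc b)
  grown-west zero    b = refl
  grown-west (suc a) b rewrite dec-true (b * m + a <? b * m + suc a) (ℕ.+-monoʳ-< (b * m) (ℕ.n<1+n a)) = refl

  grown-step : ∀ {a b} → a < m → b < n → Step 𝒯 (grown (b * m + a)) (grown (suc (b * m + a)))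
  grown-step {a} {b} a<m b<n with fin?-< a<m | fin?-< b<n
  ... | i , ea | j , eb = p , f (π i j) , attach , added , unchanged
    where
      K = b * m + a
      p : Pos
      p = (+ suc a , + suc b)
      vacant : grown K p ≡ nothing
      vacant rewrite dec-false (K <? K) (ℕ.<-irrefl refl) = refl
      added : grown (suc K) p ≡ just (f (π i j))
      added rewrite dec-true (K <? suc K) (ℕ.n<1+n K) | ea | eb = refl
      attach : CanAttach 𝒯 (grown K) p (f (π i j))
      attach = bindsOn-south-west⇒attach {A = grown K} {p = p} (f∈T _) vacant
                 (bindsOn-agree (grown-south a b) (full-south ea eb)) (bindsOn-agree (grown-west a b) (full-west ea eb))
      unchanged : ∀ q → q ≢ p → grown (suc K) q ≡ grown K q
      unchanged (+ suc a′ , + suc b′) q≢p with a′ <? m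
      ... | yes a′<m = cong (λ c → if c then full (+ suc a′ , + suc b′) else nothing) (does-<-suc index≢K)
        where
          index≢K : b′ * m + a′ ≢ K
          index≢K eq with row-major-injective m {b = b′} {b} a′<m a<m eq
          ... | refl , refl = q≢p refl
      ... | no a′≮m rewrite fin?-≥ (ℕ.≮⇒≥ a′≮m) = trans (if-const _ nothing) (sym (if-const _ nothing))
      unchanged (+ zero  , y)         _ = refl
      unchanged (+ suc _ , + zero)    _ = refl
      unchanged (+ suc _ , -[1+ _ ])  _ = refl
      unchanged (-[1+ _ ] , y)        _ = refl

  grown-produced : ∀ b a → b < n → a ≤ m → Produced 𝒯 (grown (b * m + a))
  grown-produced zero    zero    _   _   = start (λ _ → refl)
  grown-produced (suc b) zero    b<n _   =
    subst (Produced 𝒯 ∘ grown) (trans (ℕ.+-comm (b * m) m) (sym (ℕ.+-identityʳ _)))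
      (grown-produced b m (ℕ.<-trans (ℕ.n<1+n b) b<n) ℕ.≤-refl)
  grown-produced b       (suc a) b<n a<m =
    subst (Produced 𝒯 ∘ grown) (sym (ℕ.+-suc (b * m) a)) (step (grown-produced b a b<n (ℕ.<⇒≤ a<m)) (grown-step a<m b<n))

  grown-all≗full : ∀ q → grown (n′ * m + m) q ≡ full q
  grown-all≗full (+ suc a , + suc b) with a <? m | b <? n
  ... | yes a<m | yes (s≤s b≤n′) rewrite dec-true (b * m + a <? n′ * m + m) (ℕ.+-mono-≤-< (ℕ.*-monoˡ-≤ m b≤n′) a<m) = refl
  ... | no a≮m  | _       rewrite fin?-≥ (ℕ.≮⇒≥ a≮m) = if-const _ nothing
  ... | yes _   | no b≮n  rewrite fin?-≥ (ℕ.≮⇒≥ b≮n) | cellTile-nothingʳ (fin? m a) = if-const _ nothing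
  grown-all≗full (+ zero  , y)        = refl
  grown-all≗full (+ suc a , + zero)   = refl
  grown-all≗full (+ suc a , -[1+ b ]) = refl
  grown-all≗full (-[1+ a ] , y)       = refl

  full-produced : Produced 𝒯 full
  full-produced = produced-≗ (grown-produced n′ m (ℕ.n<1+n n′) ℕ.≤-refl) grown-all≗full

  module _ (det-f : DeterministicTileSet f) where

    same-south-west⇒≡ : ∀ {t c} → t ∈ T → glue t S ≡ glue (f c) S → glue t W ≡ glue (f c) W → t ≡ f c
    same-south-west⇒≡ {t} {c} t∈T eqS eqW with ∈-map⁻ f t∈T
    ... | c′ , _ , refl with f c′ ≟ᵗ f c
    ...   | yes eq  = eq
    ...   | no f≢f = ⊥-elim (det-f (c′ , c , f≢f , eqS , eqW))

    module _ {B} (B⊑full : B ⊑ full) where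

      no-lone-attach : ∀ {p t} → CanAttach 𝒯 B p t → ∀ D → (∀ D′ → D′ ≢ D → full (move D′ p) ≡ nothing) → ⊥
      no-lone-attach {p} (t∈T , _ , 2≤) D vacant =
        attach-needs-two-sides {A = B} {p = p} t∈T D (λ D′ D′≢D → ⊑-vacant {q = move D′ p} B⊑full (vacant D′ D′≢D)) 2≤

      attach-east-of-grid : ∀ {a t} → m ≤ a → ∀ y → ¬ CanAttach 𝒯 B (+ suc a , y) t
      attach-east-of-grid {a} m≤a y attach = no-lone-attach attach W λ
        { N _ → east (y ℤ.+ ℤ.1ℤ)
        ; E _ → trans (cong full (move-E (suc a) y)) (full-east-of-grid (ℕ.m≤n⇒m≤1+n m≤a) y)
        ; S _ → east (y ℤ.- ℤ.1ℤ)
        ; W W≢W → ⊥-elim (W≢W refl) }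
        where east = full-east-of-grid m≤a

      attach-north-of-grid : ∀ {b t} → n ≤ b → ∀ x → ¬ CanAttach 𝒯 B (x , + suc b) t
      attach-north-of-grid {b} n≤b x attach = no-lone-attach attach S λ
        { N _ → trans (cong full (move-N x (suc b))) (full-north-of-grid (ℕ.m≤n⇒m≤1+n n≤b) x)
        ; E _ → north (x ℤ.+ ℤ.1ℤ)
        ; S S≢S → ⊥-elim (S≢S refl)
        ; W _ → north (x ℤ.- ℤ.1ℤ) }
        where north = full-north-of-grid n≤b

      attach-grid : ∀ {a b i j t} → Produced 𝒯 B → fin? m a ≡ just i → fin? n b ≡ just j →
                    CanAttach 𝒯 B (+ suc a , + suc b) t → t ≡ f (π i j)
      attach-grid d ea eb attach =
        same-south-west⇒≡ (proj₁ attach) (glue-of (proj₁ bound) (full-south ea eb)) (glue-of (proj₂ bound) (full-west ea eb))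
        where
          bound = quadrant-attach⇒bindsOn-south-west seed-off-quadrant d attach
          glue-of : ∀ {p t u D} → BindsOn B p t D → BindsOn full p u D → glue t D ≡ glue u D
          glue-of binding = bindsOn-same-glue (bindsOn-⊑ B⊑full binding)

    attach⇒full : ∀ {B p t} → Produced 𝒯 B → B ⊑ full → CanAttach 𝒯 B p t → full p ≡ just t
    attach⇒full {p = -[1+ a ] , y} _ B⊑full attach = ⊥-elim (no-lone-attach B⊑full attach E λ
      { N _ → refl ; E E≢E → ⊥-elim (E≢E refl) ; S _ → refl ; W _ → refl })
    attach⇒full {p = + a , -[1+ b ]} _ B⊑full attach = ⊥-elim (no-lone-attach B⊑full attach N λ
      { N N≢N → ⊥-elim (N≢N refl) ; E _ → full-below (+ a ℤ.+ ℤ.1ℤ) b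
      ; S _ → full-below (+ a) (suc (b + 0)) ; W _ → full-below (+ a ℤ.- ℤ.1ℤ) b })
    attach⇒full {p = + zero , + zero} d _ attach = ⊥-elim (attach-off-seed d attach refl)
    attach⇒full {p = + suc a , + zero} d B⊑full attach with fin? m a in ea
    ... | just _  = ⊥-elim (attach-off-seed d attach (cong bottomTile ea))
    ... | nothing = ⊥-elim (attach-east-of-grid B⊑full (fin?-nothing⇒≥ m a ea) (+ 0) attach)
    attach⇒full {p = + zero , + suc b} d B⊑full attach with fin? n b in eb
    ... | just _  = ⊥-elim (attach-off-seed d attach (cong leftTile eb))
    ... | nothing = ⊥-elim (attach-north-of-grid B⊑full (fin?-nothing⇒≥ n b eb) (+ 0) attach)
    attach⇒full {p = + suc a , + suc b} d B⊑full attach with fin? m a in ea | fin? n b in eb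
    ... | nothing | _       = ⊥-elim (attach-east-of-grid B⊑full (fin?-nothing⇒≥ m a ea) _ attach)
    ... | just _  | nothing = ⊥-elim (attach-north-of-grid B⊑full (fin?-nothing⇒≥ n b eb) _ attach)
    ... | just _  | just _  = cong just (sym (attach-grid B⊑full d ea eb attach))

    produced⊑full : ∀ {B} → Produced 𝒯 B → B ⊑ full
    produced⊑full (start B≗seed) q eq = grown⊑full 0 q (trans (sym (B≗seed q)) eq)
    produced⊑full (step d (p , t , attach , Bp , elsewhere)) q eq with q ≟ᵖ p
    ... | yes refl = trans (attach⇒full d (produced⊑full d) attach) (trans (sym Bp) eq)
    ... | no q≢p   = produced⊑full d q (trans (sym (elsewhere q q≢p)) eq)

    produced-attach⇒full : ∀ {B p t} → Produced 𝒯 B → CanAttach 𝒯 B p t → full p ≡ just t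
    produced-attach⇒full d = attach⇒full d (produced⊑full d)

    deterministic : Deterministic 𝒯
    deterministic B d p t₁ t₂ attach₁ attach₂ =
      just-injective (trans (sym (produced-attach⇒full d attach₁)) (produced-attach⇒full d attach₂))

    full-terminal : Terminal 𝒯 full
    full-terminal = full-produced , λ p t attach →
      nothing≢just (trans (sym (proj₁ (proj₂ attach))) (produced-attach⇒full {p = p} full-produced attach))

    module _ {B} (d : Produced 𝒯 B) (maximal : ∀ p t → ¬ CanAttach 𝒯 B p t) where

      supported : ∀ {p t D w} → B (move D p) ≡ just w → BindsOn full p t D → BindsOn B p t D
      supported present = bindsOn-agree (trans present (sym (produced⊑full d _ present)))

      mutual
        occupies-grid : ∀ a b {i j} → fin? m a ≡ just i → fin? n b ≡ just j → Defined B (+ suc a , + suc b)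
        occupies-grid a b {i} {j} ea eb with B (+ suc a , + suc b) in eq
        ... | just u  = u , refl
        ... | nothing = ⊥-elim (maximal _ (f (π i j)) (bindsOn-south-west⇒attach {A = B} {p = _ , _} (f∈T _) eq
                          (supported (proj₂ (occupies-south a b ea eb)) (full-south ea eb))
                          (supported (proj₂ (occupies-west a b ea eb)) (full-west ea eb))))

        occupies-south : ∀ a b {i j} → fin? m a ≡ just i → fin? n b ≡ just j → Defined B (+ suc a , + b)
        occupies-south a zero    ea _  = _ , seed⊑produced d _ (cong bottomTile ea)
        occupies-south a (suc b) ea eb = occupies-grid a b ea (proj₂ (fin?-pred n b eb))

        occupies-west : ∀ a b {i j} → fin? m a ≡ just i → fin? n b ≡ just j → Defined B (+ a , + suc b)
        occupies-west zero    b _  eb = _ , seed⊑produced d _ (cong leftTile eb)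
        occupies-west (suc a) b ea eb = occupies-grid a b (proj₂ (fin?-pred m a ea)) eb

      occupies-rectangle : ∀ x y → InRange 𝒯 m x × InRange 𝒯 n y → Defined B (x , y)
      occupies-rectangle (+ zero)  (+ zero)  _ = _ , seed⊑produced d _ refl
      occupies-rectangle (+ suc a) (+ zero)  (in-range , _) =
        _ , seed⊑produced d _ (proj₂ (from (map-fin?-defined⇔ m a _) (+-in-range⁻ 𝒯 in-range)))
      occupies-rectangle (+ zero)  (+ suc b) (_ , in-range) =
        _ , seed⊑produced d _ (proj₂ (from (map-fin?-defined⇔ n b _) (+-in-range⁻ 𝒯 in-range)))
      occupies-rectangle (+ suc a) (+ suc b) (in-rangeˣ , in-rangeʸ) =
        occupies-grid a b (proj₂ (fin?-< (+-in-range⁻ 𝒯 in-rangeˣ))) (proj₂ (fin?-< (+-in-range⁻ 𝒯 in-rangeʸ)))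
      occupies-rectangle -[1+ _ ]  _         (in-range , _) = ⊥-elim (-[1+]-not-in-range 𝒯 in-range)
      occupies-rectangle (+ _)     -[1+ _ ]  (_ , in-range) = ⊥-elim (-[1+]-not-in-range 𝒯 in-range)

    terminal-domain : ∀ B → Terminal 𝒯 B → ∀ x y → Defined B (x , y) ⇔ (InRange 𝒯 m x × InRange 𝒯 n y)
    terminal-domain B (d , maximal) x y =
      mk⇔ (λ (_ , eq) → full-domain x y (produced⊑full d _ eq)) (occupies-rectangle d maximal x y)

    full-induces : Injective _≡_ _≡_ f → InducesPartition π full
    full-induces f-injective i j i′ j′ = mk⇔
      (λ eq → f-injective (just-injective (trans (sym (full-gridPos i j)) (trans eq (full-gridPos i′ j′)))))
      (λ eq → trans (full-gridPos i j) (trans (cong (just ∘ f) eq) (sym (full-gridPos i′ j′))))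

    constructible : Injective _≡_ _≡_ f → Constructible m n k π
    constructible f-injective =
      𝒯 , deterministic , p1 , (seed-domain , terminal-domain) , full , full-terminal , full-induces f-injective

lemma3 : (m n : ℕ) → 1 ≤ m → 1 ≤ n → (k : ℕ) (π : Fin m → Fin n → Fin k) →
    IsPartitionLabelling m n k π → (f : Fin k → Tile) → IsMGTA π f →
    Constructible m n k π ⇔ (Injective _≡_ _≡_ f × DeterministicTileSet f)
lemma3 (suc m′) (suc n′) _ _ k π surj f mgta = mk⇔
  (λ (𝒯 , det , p1 , p2 , A , terminal , induces) →
     let open Necessity π surj 𝒯 det p1 p2 A terminal induces
     in mgta-injective mgta , mgta-deterministic mgta)
  (λ (f-injective , det-f) → Sufficiency.constructible π f (proj₁ mgta) det-f f-injective)
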